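{- If $G\in\{K_2,K_3,K_4,H_3\}\cup\mathcal{H}_1\cup\mathcal{H}_2\cup\{K_{1,n}: n\in\mathbb{N}\}$, then $G$ is well-edge-dominated.
   Context: All graphs are finite and simple. $\mathcal{H}_1$ is the family of graphs obtained by appending any finite number of leaves (new degree-one vertices) to a single vertex of $K_4$. $\mathcal{H}_2$ is the family of graphs obtained from $K_4$ by removing an edge $uv$ and appending at least one leaf to $u$. $H_3$ is the graph of order $5$ obtained from $K_4-e$ (i.e. $K_4$ minus one edge) by adding a new vertex adjacent to one of the vertices of degree $2$ and one of the vertices of degree $3$. A set $F$ of edges is an edge dominating set if every edge not in $F$ shares an endpoint with some edge of $F$; it is minimal if no proper subset is. A graph is well-edge-dominated if all its minimal edge dominating sets have the same cardinality. -}

module Defs where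

open import Data.Nat using (ℕ; zero; suc; _+_; _≡ᵇ_; _<ᵇ_)
open import Data.Fin using (Fin; toℕ; _≟_)
open import Data.Bool using (Bool; true; false; not; _∧_; _∨_; if_then_else_)
open import Data.Bool.Properties using (∨-comm)
open import Data.List using (List; map; allFin)
open import Data.Nat.ListAction using (sum)
open import Data.Product using (Σ; ∃; _×_; _,_)
open import Data.Sum using (_⊎_)
open import Data.Empty using (⊥-elim)
open import Relation.Nullary using (¬_; does; yes; no)
open import Relation.Binary.PropositionalEquality using (_≡_; refl; sym)

record Graph : Set where
  field
    n          : ℕ
    adj        : Fin n → Fin n → Bool
    adj-sym    : ∀ u v → adj u v ≡ adj v u
    adj-irrefl : ∀ u → adj u u ≡ false

open Graph public

record EdgeSet (G : Graph) : Set where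
  field
    mem     : Fin (n G) → Fin (n G) → Bool
    mem-sym : ∀ u v → mem u v ≡ mem v u
    mem-sub : ∀ u v → mem u v ≡ true → adj G u v ≡ true

open EdgeSet public

size : {G : Graph} → EdgeSet G → ℕ
size {G} F =
  sum (map (λ u → sum (map (λ v → if (toℕ u <ᵇ toℕ v) ∧ mem F u v then 1 else 0)
                           (allFin (n G))))
           (allFin (n G)))

IsEDS : {G : Graph} → EdgeSet G → Set
IsEDS {G} F = ∀ u v → adj G u v ≡ true → mem F u v ≡ false →
  ∃ λ w → (mem F u w ≡ true) ⊎ (mem F v w ≡ true)

_⊂_ : {G : Graph} → EdgeSet G → EdgeSet G → Set
_⊂_ {G} F' F =
  (∀ u v → mem F' u v ≡ true → mem F u v ≡ true) ×
  (∃ λ u → ∃ λ v → (mem F u v ≡ true) × (mem F' u v ≡ false))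

IsMinimalEDS : {G : Graph} → EdgeSet G → Set
IsMinimalEDS {G} F = IsEDS F × (∀ (F' : EdgeSet G) → F' ⊂ F → ¬ IsEDS F')

WellEdgeDominated : Graph → Set
WellEdgeDominated G =
  ∀ (F F' : EdgeSet G) → IsMinimalEDS F → IsMinimalEDS F' → size F ≡ size F'

record _≅_ (G H : Graph) : Set where
  field
    to       : Fin (n G) → Fin (n H)
    from     : Fin (n H) → Fin (n G)
    from-to  : ∀ u → from (to u) ≡ u
    to-from  : ∀ v → to (from v) ≡ v
    adj-pres : ∀ u v → adj H (to u) (to v) ≡ adj G u v

mkAdj : (k : ℕ) → (ℕ → ℕ → Bool) → Fin k → Fin k → Bool
mkAdj k r i j = not (does (i ≟ j)) ∧ (r (toℕ i) (toℕ j) ∨ r (toℕ j) (toℕ i))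

mkAdj-sym : ∀ k r (i j : Fin k) → mkAdj k r i j ≡ mkAdj k r j i
mkAdj-sym k r i j with i ≟ j | j ≟ i
... | yes _ | yes _ = refl
... | yes p | no q  = ⊥-elim (q (sym p))
... | no q  | yes p = ⊥-elim (q (sym p))
... | no _  | no _  = ∨-comm (r (toℕ i) (toℕ j)) (r (toℕ j) (toℕ i))

mkAdj-irrefl : ∀ k r (i : Fin k) → mkAdj k r i i ≡ false
mkAdj-irrefl k r i with i ≟ i
... | yes _ = refl
... | no p  = ⊥-elim (p refl)

mkGraph : (k : ℕ) → (ℕ → ℕ → Bool) → Graph
mkGraph k r = record
  { n = k ; adj = mkAdj k r ; adj-sym = mkAdj-sym k r ; adj-irrefl = mkAdj-irrefl k r }

K : ℕ → Graph
K k = mkGraph k (λ _ _ → true)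

Star : ℕ → Graph
Star m = mkGraph (suc m) (λ a b → (a ≡ᵇ 0) ∧ not (b ≡ᵇ 0))

K4-minus-01 : ℕ → ℕ → Bool
K4-minus-01 a b = (a <ᵇ 4) ∧ (b <ᵇ 4) ∧ not ((a + b) ≡ᵇ 1)

-- ℋ₁: K_4 on {0,1,2,3} with k leaves 4..3+k appended to vertex 0 (k ≥ 0)
H1 : ℕ → Graph
H1 k = mkGraph (4 + k) (λ a b → ((a <ᵇ 4) ∧ (b <ᵇ 4)) ∨ ((a ≡ᵇ 0) ∧ not (b <ᵇ 4)))

-- ℋ₂: K_4 − uv with u = 0, v = 1, and suc k ≥ 1 leaves appended to u = 0
H2 : ℕ → Graph
H2 k = mkGraph (4 + suc k) (λ a b → K4-minus-01 a b ∨ ((a ≡ᵇ 0) ∧ not (b <ᵇ 4)))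

-- H₃: K_4 − {0,1} (0,1 of degree 2; 2,3 of degree 3) plus vertex 4
-- adjacent to 0 (degree 2) and 2 (degree 3)
H3 : Graph
H3 = mkGraph 5 (λ a b → K4-minus-01 a b ∨ ((a ≡ᵇ 4) ∧ ((b ≡ᵇ 0) ∨ (b ≡ᵇ 2))))

InFamily : Graph → Set
InFamily G =
  (G ≅ K 2) ⊎ (G ≅ K 3) ⊎ (G ≅ K 4) ⊎ (G ≅ H3) ⊎
  (∃ λ k → G ≅ H1 k) ⊎ (∃ λ k → G ≅ H2 k) ⊎ (∃ λ m → G ≅ Star m)

-- For the infinite families (stars, ℋ₁, ℋ₂) every minimal edge dominating
-- set F contains one or two edges whose endpoints form a vertex cover; such
-- edges already dominate every edge, so by minimality F consists of exactly
-- these edges, and all minimal edge dominating sets have the same size.  The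
-- finitely many remaining graphs are settled by enumerating all edge subsets.
-- Sizes transfer along isomorphisms because twice the size of F is the number
-- of ordered pairs in F, which is invariant under relabelling the vertices.
module Submission where

open import Defs
open import Data.Nat.Properties using (+-0-commutativeMonoid; +-suc; n≡⌊n+n/2⌋)
open import Algebra.Properties.CommutativeMonoid.Sum +-0-commutativeMonoid
  using (∑-distrib-+; ∑-comm; sum-permute; sum-cong-≗; sum-replicate-zero)
  renaming (sum to ∑)
open import Data.Bool using (Bool; true; false; not; _∧_; _∨_; if_then_else_)
import Data.Bool as Bool
open import Data.Bool.ListAction using (any)
open import Data.Bool.Properties using (∧-comm; ∨-comm; ∧-zeroʳ; ∧-identityʳ; ∨-zeroʳ)
open import Data.Empty using (⊥; ⊥-elim)
open import Data.Fin using (Fin; zero; suc; toℕ; _≟_)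
open import Data.Fin.Patterns using (0F; 1F; 2F; 3F)
open import Data.Fin.Permutation using (Permutation; permutation)
import Data.Fin.Properties as Finₚ
open import Data.Fin.Properties using (toℕ-injective)
open import Data.Fin.Subset using (Subset)
open import Data.Fin.Subset.Properties using (anySubset?)
open import Data.List using (List; []; _∷_; length; allFin; tabulate; filterᵇ; cartesianProduct)
import Data.List as List
open import Data.List.Properties using (map-cong)
open import Data.List.Relation.Unary.All using (All; []; _∷_)
import Data.List.Relation.Unary.All as All
open import Data.List.Relation.Unary.AllPairs using (AllPairs; []; _∷_)
open import Data.Nat using (ℕ; zero; suc; _+_; _<ᵇ_; _≡ᵇ_; ⌊_/2⌋)
import Data.Nat as ℕ
open import Data.Nat.ListAction using (sum)
open import Data.Product using (∃; _×_; _,_; proj₁; proj₂)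
import Data.Product as Product
open import Data.Sum using (_⊎_; inj₁; inj₂)
import Data.Sum as Sum
open import Data.Vec using ([]; _∷_)
open import Function using (_∘_; id)
open import Relation.Nullary using (¬_; Dec; does; yes; no; contradiction)
open import Relation.Nullary.Decidable
  using (True; toWitness; map′; ¬?; _×-dec_; _⊎-dec_; _→-dec_; decidable-stable; dec-true)
open import Relation.Binary.PropositionalEquality

∨≡true : ∀ {x y} → x ∨ y ≡ true → x ≡ true ⊎ y ≡ true
∨≡true {true}  _       = inj₁ refl
∨≡true {false} y≡true = inj₂ y≡true

∧≡true : ∀ {x y} → x ∧ y ≡ true → x ≡ true × y ≡ true
∧≡true {true} y≡true = refl , y≡true

∨-∧-absorb : ∀ x m s → (x ≡ true → m ≡ true) → x ∨ (m ∧ s) ≡ m ∧ (x ∨ s)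
∨-∧-absorb true  m s m≡true rewrite m≡true refl = refl
∨-∧-absorb false m s _                          = refl

∧-∨-absorb : ∀ x m s → (x ≡ true → m ≡ false) → m ∧ s ≡ m ∧ (x ∨ s)
∧-∨-absorb true  m s m≡false rewrite m≡false refl = refl
∧-∨-absorb false m s _                            = refl

Edge : ℕ → Set
Edge n = Fin n × Fin n

Rel : ℕ → Set
Rel n = Fin n → Fin n → Bool

_≗₂_ : ∀ {n} → Rel n → Rel n → Set
r ≗₂ s = ∀ u v → r u v ≡ s u v

_==_ : ∀ {n} → Fin n → Fin n → Bool
x == y = does (x ≟ y)

==-refl : ∀ {n} (x : Fin n) → x == x ≡ true
==-refl x = dec-true (x ≟ x) refl

==⇒≡ : ∀ {n} {x y : Fin n} → x == y ≡ true → x ≡ y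
==⇒≡ {x = x} {y} _ with x ≟ y
==⇒≡ _  | yes x≡y = x≡y
==⇒≡ () | no _

linked : ∀ {n} → Edge n → Rel n
linked (a , b) u v = (u == a ∧ v == b) ∨ (u == b ∧ v == a)

linked-sym : ∀ {n} (e : Edge n) u v → linked e u v ≡ linked e v u
linked-sym (a , b) u v =
  trans (cong₂ _∨_ (∧-comm (u == a) (v == b)) (∧-comm (u == b) (v == a)))
        (∨-comm (v == b ∧ u == a) (v == a ∧ u == b))

linked-self : ∀ {n} (a b : Fin n) → linked (a , b) a b ≡ true
linked-self a b rewrite ==-refl a | ==-refl b = refl

linked⇒ : ∀ {n} {a b u v : Fin n} → linked (a , b) u v ≡ true → (u ≡ a × v ≡ b) ⊎ (u ≡ b × v ≡ a)
linked⇒ {a = a} {b} {u} {v} l with u == a in ua | v == b in vb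
... | true  | true  = inj₁ (==⇒≡ ua , ==⇒≡ vb)
... | true  | false = inj₂ (Product.map ==⇒≡ ==⇒≡ (∧≡true l))
... | false | _     = inj₂ (Product.map ==⇒≡ ==⇒≡ (∧≡true l))

linked-resp : ∀ {n} (e : Edge n) {c d u v} → linked (c , d) u v ≡ true → linked e u v ≡ linked e c d
linked-resp e {c} {d} {u} {v} l with linked⇒ {a = c} {d} {u} {v} l
... | inj₁ (refl , refl) = refl
... | inj₂ (refl , refl) = linked-sym e d c

spanned : ∀ {n} → List (Edge n) → Rel n
spanned es u v = any (λ e → linked e u v) es

spanned-sym : ∀ {n} (es : List (Edge n)) u v → spanned es u v ≡ spanned es v u
spanned-sym []       u v = refl
spanned-sym (e ∷ es) u v = cong₂ _∨_ (linked-sym e u v) (spanned-sym es u v)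

spanned-∷ʳ : ∀ {n} (e : Edge n) {es u v} → spanned es u v ≡ true → spanned (e ∷ es) u v ≡ true
spanned-∷ʳ e {u = u} {v} p = trans (cong (linked e u v ∨_) p) (∨-zeroʳ _)

incident : ∀ {n} → List (Edge n) → Fin n → Bool
incident es x = any (λ (a , b) → x == a ∨ x == b) es

incident⇒spanned : ∀ {n} (es : List (Edge n)) x → incident es x ≡ true → ∃ λ w → spanned es x w ≡ true
incident⇒spanned ((a , b) ∷ es) x p with ∨≡true {x == a ∨ x == b} p
... | inj₂ q = let w , xw = incident⇒spanned es x q in w , spanned-∷ʳ (a , b) {es} {x} {w} xw
... | inj₁ q with ∨≡true {x == a} q
...   | inj₁ xa with refl ← ==⇒≡ {x = x} xa =
  b , cong (_∨ spanned es a b) (linked-self a b)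
...   | inj₂ xb with refl ← ==⇒≡ {x = x} xb =
  a , cong (_∨ spanned es b a) (trans (linked-sym (a , b) b a) (linked-self a b))

Distinct : ∀ {n} → Edge n → Edge n → Set
Distinct e (c , d) = linked e c d ≡ false

disjoint-spanned : ∀ {n} (e : Edge n) {es} → All (Distinct e) es → ∀ u v → linked e u v ∧ spanned es u v ≡ false
disjoint-spanned e []                        u v = ∧-zeroʳ _
disjoint-spanned e {(c , d) ∷ _} (e≠cd ∷ rest) u v with linked (c , d) u v in l
... | true rewrite linked-resp e {c} {d} {u} {v} l | e≠cd = refl
... | false = disjoint-spanned e rest u v

count : Bool → ℕ
count b = if b then 1 else 0

∑² : ∀ {n} → (Fin n → Fin n → ℕ) → ℕ
∑² f = ∑ λ u → ∑ λ v → f u v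

∑²-cong : ∀ {n} {f g : Fin n → Fin n → ℕ} → (∀ u v → f u v ≡ g u v) → ∑² f ≡ ∑² g
∑²-cong f≗g = sum-cong-≗ λ u → sum-cong-≗ (f≗g u)

∑²-distrib-+ : ∀ {n} (f g : Fin n → Fin n → ℕ) → ∑² (λ u v → f u v + g u v) ≡ ∑² f + ∑² g
∑²-distrib-+ f g = trans (sum-cong-≗ λ u → ∑-distrib-+ (f u) (g u)) (∑-distrib-+ (λ u → ∑ (f u)) (λ u → ∑ (g u)))

∑²-zero : ∀ n → ∑² {n} (λ _ _ → 0) ≡ 0
∑²-zero zero    = refl
∑²-zero (suc n) = cong₂ _+_ (sum-replicate-zero (suc n)) (∑²-zero n)

∑-count-== : ∀ {n} (b : Fin n) → ∑ (λ v → count (v == b)) ≡ 1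
∑-count-== {suc n} zero    = cong suc (sum-replicate-zero n)
∑-count-== {suc n} (suc b) = ∑-count-== b

∑²-count-== : ∀ {n} (a b : Fin n) → ∑² (λ u v → count (u == a ∧ v == b)) ≡ 1
∑²-count-== {n} a b = trans (sum-cong-≗ row) (∑-count-== a)
  where
  row : ∀ u → ∑ (λ v → count (u == a ∧ v == b)) ≡ count (u == a)
  row u with u == a
  ... | true  = ∑-count-== b
  ... | false = sum-replicate-zero n

count-∨ : ∀ x y → x ∧ y ≡ false → count (x ∨ y) ≡ count x + count y
count-∨ true  false _ = refl
count-∨ false y     _ = refl

count-<ᵇ : ∀ x y → x ≢ y → count (x <ᵇ y) + count (y <ᵇ x) ≡ 1
count-<ᵇ zero    zero    x≢y = contradiction refl x≢y
count-<ᵇ zero    (suc y) _   = refl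
count-<ᵇ (suc x) zero    _   = refl
count-<ᵇ (suc x) (suc y) x≢y = count-<ᵇ x y (x≢y ∘ cong suc)

arcs : ∀ {n} → Rel n → ℕ
arcs r = ∑² λ u v → count (r u v)

arcs-∨ : ∀ {n} (r s : Rel n) → (∀ u v → r u v ∧ s u v ≡ false) →
         arcs (λ u v → r u v ∨ s u v) ≡ arcs r + arcs s
arcs-∨ r s disjoint =
  trans (∑²-cong λ u v → count-∨ (r u v) (s u v) (disjoint u v)) (∑²-distrib-+ (λ u v → count (r u v)) (λ u v → count (s u v)))

arcs-linked : ∀ {n} {a b : Fin n} → a ≢ b → arcs (linked (a , b)) ≡ 2
arcs-linked {a = a} {b} a≢b =
  trans (arcs-∨ _ _ disjoint) (cong₂ _+_ (∑²-count-== a b) (∑²-count-== b a))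
  where
  disjoint : ∀ u v → (u == a ∧ v == b) ∧ (u == b ∧ v == a) ≡ false
  disjoint u v with u == a in ua | u == b in ub
  ... | true  | true  = contradiction (trans (sym (==⇒≡ {x = u} ua)) (==⇒≡ {x = u} ub)) a≢b
  ... | true  | false = ∧-zeroʳ (v == b)
  ... | false | _     = refl

arcs-spanned : ∀ {n} {es : List (Edge n)} → All (λ (a , b) → a ≢ b) es → AllPairs Distinct es →
               arcs (spanned es) ≡ length es + length es
arcs-spanned {n} {[]} [] [] = ∑²-zero n
arcs-spanned {es = e ∷ es} (a≢b ∷ loopless) (e≠es ∷ distinct) = begin
  arcs (λ u v → linked e u v ∨ spanned es u v)  ≡⟨ arcs-∨ _ _ (disjoint-spanned e e≠es) ⟩
  arcs (linked e) + arcs (spanned es)          ≡⟨ cong₂ _+_ (arcs-linked a≢b) (arcs-spanned loopless distinct) ⟩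
  suc (suc (length es + length es))            ≡⟨ cong suc (sym (+-suc (length es) (length es))) ⟩
  suc (length es) + suc (length es)            ∎
  where open ≡-Reasoning

-- Coincides definitionally with size F for r = mem F.
edgeCount : ∀ {n} → Rel n → ℕ
edgeCount {n} r =
  sum (List.map (λ u → sum (List.map (λ v → if (toℕ u <ᵇ toℕ v) ∧ r u v then 1 else 0)
                                     (allFin n)))
                (allFin n))

edgeCount-cong : ∀ {n} {r s : Rel n} → r ≗₂ s → edgeCount r ≡ edgeCount s
edgeCount-cong {n} r≗s = cong sum (map-cong (λ u → cong sum (map-cong (λ v →
  cong (λ b → count ((toℕ u <ᵇ toℕ v) ∧ b)) (r≗s u v)) (allFin n))) (allFin n))

sum-map-tabulate : ∀ {A : Set} {n} (f : A → ℕ) (g : Fin n → A) → sum (List.map f (tabulate g)) ≡ ∑ (f ∘ g)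
sum-map-tabulate {n = zero}  f g = refl
sum-map-tabulate {n = suc n} f g = cong (f (g zero) +_) (sum-map-tabulate f (g ∘ suc))

edgeCount≡∑² : ∀ {n} (r : Rel n) → edgeCount r ≡ ∑² λ u v → count ((toℕ u <ᵇ toℕ v) ∧ r u v)
edgeCount≡∑² {n} r =
  trans (sum-map-tabulate (λ u → sum (List.map (λ v → count ((toℕ u <ᵇ toℕ v) ∧ r u v)) (allFin n))) id)
        (sum-cong-≗ λ u → sum-map-tabulate (λ v → count ((toℕ u <ᵇ toℕ v) ∧ r u v)) id)

non-edge-∉ : ∀ {G} (F : EdgeSet G) {u v} → adj G u v ≡ false → mem F u v ≡ true → ⊥
non-edge-∉ {G} F ¬uv uv = contradiction (trans (sym ¬uv) (mem-sub F _ _ uv)) λ ()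

mem⇒≢ : ∀ {G} (F : EdgeSet G) {u v} → mem F u v ≡ true → u ≢ v
mem⇒≢ {G} F {u} uv refl = non-edge-∉ F (adj-irrefl G u) uv

arcs-size : ∀ {G} (F : EdgeSet G) → arcs (mem F) ≡ size F + size F
arcs-size {G} F = begin
  arcs (mem F)                                     ≡⟨ ∑²-cong split ⟩
  ∑² (λ u v → below u v + below v u)               ≡⟨ ∑²-distrib-+ below (λ u v → below v u) ⟩
  ∑² below + ∑² (λ u v → below v u)                ≡⟨ cong (∑² below +_) (∑-comm (λ u v → below v u)) ⟩
  ∑² below + ∑² below                              ≡⟨ cong₂ _+_ (sym (edgeCount≡∑² (mem F))) (sym (edgeCount≡∑² (mem F))) ⟩
  size F + size F                                  ∎
  where
  open ≡-Reasoning
  below : Fin (n G) → Fin (n G) → ℕ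
  below u v = count ((toℕ u <ᵇ toℕ v) ∧ mem F u v)
  split : ∀ u v → count (mem F u v) ≡ below u v + below v u
  split u v rewrite mem-sym F v u with mem F u v in uv
  ... | false rewrite ∧-zeroʳ (toℕ u <ᵇ toℕ v) | ∧-zeroʳ (toℕ v <ᵇ toℕ u) = refl
  ... | true  rewrite ∧-identityʳ (toℕ u <ᵇ toℕ v) | ∧-identityʳ (toℕ v <ᵇ toℕ u) =
    sym (count-<ᵇ (toℕ u) (toℕ v) (mem⇒≢ F uv ∘ toℕ-injective))

+-double-injective : ∀ {m k} → m + m ≡ k + k → m ≡ k
+-double-injective {m} {k} eq = trans (n≡⌊n+n/2⌋ m) (trans (cong ⌊_/2⌋ eq) (sym (n≡⌊n+n/2⌋ k)))

Dominates : (G : Graph) → Rel (n G) → Set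
Dominates G r = ∀ u v → adj G u v ≡ true → r u v ≡ false →
  ∃ λ w → (r u w ≡ true) ⊎ (r v w ≡ true)

Dominates-resp : ∀ {G} {r s : Rel (n G)} → r ≗₂ s → Dominates G r → Dominates G s
Dominates-resp r≗s dom u v uv ¬suv with dom u v uv (trans (r≗s u v) ¬suv)
... | w , p = w , Sum.map (trans (sym (r≗s u w))) (trans (sym (r≗s v w))) p

EDS-touches : ∀ {G} (F : EdgeSet G) → IsEDS F → ∀ {u v} → adj G u v ≡ true →
              (∃ λ w → mem F u w ≡ true) ⊎ (∃ λ w → mem F v w ≡ true)
EDS-touches F eds {u} {v} uv with mem F u v in f
... | true  = inj₁ (v , f)
... | false with eds u v uv f
...   | w , p = Sum.map (w ,_) (w ,_) p

minimal⇒sub-EDS-equal : ∀ {G} {F : EdgeSet G} → IsMinimalEDS F → (S : EdgeSet G) →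
  (∀ u v → mem S u v ≡ true → mem F u v ≡ true) → IsEDS S → mem F ≗₂ mem S
minimal⇒sub-EDS-equal {F = F} (_ , minimal) S S⊆F eds u v with mem S u v in s
... | true  = S⊆F u v s
... | false with mem F u v in f
...   | false = refl
...   | true  = ⊥-elim (minimal S (S⊆F , u , v , f , s) eds)

without : ∀ {n} → Edge n → Rel n → Rel n
without e r u v = r u v ∧ not (linked e u v)

Irredundant : (G : Graph) → Rel (n G) → Set
Irredundant G r = ∀ a b → r a b ≡ true → ¬ Dominates G (without (a , b) r)

Irredundant-resp : ∀ {G} {r s : Rel (n G)} → r ≗₂ s → Irredundant G r → Irredundant G s
Irredundant-resp {G} {r} {s} r≗s irr a b sab dom =
  irr a b (trans (r≗s a b) sab)
    (Dominates-resp {G} {without (a , b) s} {without (a , b) r}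
       (λ u v → cong (_∧ not (linked (a , b) u v)) (sym (r≗s u v))) dom)

minimal⇒Irredundant : ∀ {G} {F : EdgeSet G} → IsMinimalEDS F → Irredundant G (mem F)
minimal⇒Irredundant {G} {F} (_ , minimal) a b ab =
  minimal F∖ab ((λ u v → proj₁ ∘ ∧≡true) , a , b , ab , removed)
  where
  F∖ab : EdgeSet G
  F∖ab = record
    { mem     = without (a , b) (mem F)
    ; mem-sym = λ u v → cong₂ (λ x y → x ∧ not y) (mem-sym F u v) (linked-sym (a , b) u v)
    ; mem-sub = λ u v → mem-sub F u v ∘ proj₁ ∘ ∧≡true
    }
  removed : without (a , b) (mem F) a b ≡ false
  removed rewrite ab | linked-self a b = refl

MinimalEDSsHaveSize : Graph → ℕ → Set
MinimalEDSsHaveSize G c = ∀ (F : EdgeSet G) → IsMinimalEDS F → size F ≡ c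

MinimalEDSsHaveSize⇒WellEdgeDominated : ∀ {G c} → MinimalEDSsHaveSize G c → WellEdgeDominated G
MinimalEDSsHaveSize⇒WellEdgeDominated sized F F′ minimal minimal′ =
  trans (sized F minimal) (sym (sized F′ minimal′))

module _ {G H : Graph} (i : G ≅ H) where
  open _≅_ i

  adj-from : ∀ a b → adj G (from a) (from b) ≡ adj H a b
  adj-from a b = trans (sym (adj-pres (from a) (from b))) (cong₂ (adj H) (to-from a) (to-from b))

  transport : EdgeSet G → EdgeSet H
  transport F = record
    { mem     = λ a b → mem F (from a) (from b)
    ; mem-sym = λ a b → mem-sym F (from a) (from b)
    ; mem-sub = λ a b → trans (sym (adj-from a b)) ∘ mem-sub F (from a) (from b)
    }

  transport-EDS : (F : EdgeSet G) → IsEDS F → IsEDS (transport F)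
  transport-EDS F eds a b ab ¬Fab with eds (from a) (from b) (trans (adj-from a b) ab) ¬Fab
  ... | w , p = to w , Sum.map (trans (cong (mem F (from a)) (from-to w)))
                               (trans (cong (mem F (from b)) (from-to w))) p

≅-sym : ∀ {G H} → G ≅ H → H ≅ G
≅-sym i = record
  { to = from ; from = to ; from-to = to-from ; to-from = from-to ; adj-pres = adj-from i }
  where open _≅_ i

module _ {G H : Graph} (i : G ≅ H) where
  open _≅_ i

  transport-minimal : {F : EdgeSet G} → IsMinimalEDS F → IsMinimalEDS (transport i F)
  transport-minimal {F} (eds , minimal) = transport-EDS i F eds , λ where
    F′ (F′⊆ , a , b , Fab , ¬F′ab) eds′ →
      minimal (transport (≅-sym i) F′)
        ( (λ u v F′uv → trans (cong₂ (mem F) (sym (from-to u)) (sym (from-to v))) (F′⊆ (to u) (to v) F′uv))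
        , from a , from b , Fab , trans (cong₂ (mem F′) (to-from a) (to-from b)) ¬F′ab )
        (transport-EDS (≅-sym i) F′ eds′)

  arcs-transport : (F : EdgeSet G) → arcs (mem (transport i F)) ≡ arcs (mem F)
  arcs-transport F = sym (trans (sum-permute (λ u → ∑ λ v → count (mem F u v)) π)
                                (sum-cong-≗ λ a → sum-permute (λ v → count (mem F (from a) v)) π))
    where
    π : Permutation (n H) (n G)
    π = permutation from to from-to to-from

  size-transport : (F : EdgeSet G) → size (transport i F) ≡ size F
  size-transport F = +-double-injective
    (trans (sym (arcs-size (transport i F))) (trans (arcs-transport F) (arcs-size F)))

  ≅-MinimalEDSsHaveSize : ∀ {c} → MinimalEDSsHaveSize H c → MinimalEDSsHaveSize G c
  ≅-MinimalEDSsHaveSize sized F minimal =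
    trans (sym (size-transport F)) (sized (transport i F) (transport-minimal {F} minimal))

-- Small graphs, by enumeration of all edge subsets

edgeList : (G : Graph) → List (Edge (n G))
edgeList G = filterᵇ (λ (u , v) → (toℕ u <ᵇ toℕ v) ∧ adj G u v) (cartesianProduct (allFin (n G)) (allFin (n G)))

chosen : ∀ {A : Set} (xs : List A) → Subset (length xs) → List A
chosen []       []          = []
chosen (x ∷ xs) (true ∷ s)  = x ∷ chosen xs s
chosen (x ∷ xs) (false ∷ s) = chosen xs s

membership : ∀ {G} → EdgeSet G → (es : List (Edge (n G))) → Subset (length es)
membership F []             = []
membership F ((a , b) ∷ es) = mem F a b ∷ membership F es

linked-mem : ∀ {G} (F : EdgeSet G) {a b u v} → linked (a , b) u v ≡ true → mem F u v ≡ mem F a b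
linked-mem F {a} {b} {u} {v} l with linked⇒ {a = a} {b} {u} {v} l
... | inj₁ (refl , refl) = refl
... | inj₂ (refl , refl) = mem-sym F _ _

spanned-chosen-membership : ∀ {G} (F : EdgeSet G) es u v →
  spanned (chosen es (membership F es)) u v ≡ mem F u v ∧ spanned es u v
spanned-chosen-membership F [] u v = sym (∧-zeroʳ _)
spanned-chosen-membership F ((a , b) ∷ es) u v with mem F a b in ab
... | true  = trans (cong (linked (a , b) u v ∨_) (spanned-chosen-membership F es u v))
                    (∨-∧-absorb (linked (a , b) u v) _ _ λ l → trans (linked-mem F l) ab)
... | false = trans (spanned-chosen-membership F es u v)
                    (∧-∨-absorb (linked (a , b) u v) _ _ λ l → trans (linked-mem F l) ab)

mem≗chosen : ∀ {G} (F : EdgeSet G) es → (∀ u v → adj G u v ≡ true → spanned es u v ≡ true) →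
             mem F ≗₂ spanned (chosen es (membership F es))
mem≗chosen F es covers u v with mem F u v in uv
... | false = sym (trans (spanned-chosen-membership F es u v) (cong (_∧ spanned es u v) uv))
... | true  = sym (trans (spanned-chosen-membership F es u v)
                         (trans (cong (_∧ spanned es u v) uv) (covers u v (mem-sub F u v uv))))

selection : (G : Graph) → Subset (length (edgeList G)) → Rel (n G)
selection G s = spanned (chosen (edgeList G) s)

-- Minimality is tested only through its consequence Irredundant, which already pins down the size.
Certificate : Graph → ℕ → Set
Certificate G c =
  (∀ u v → adj G u v ≡ true → spanned (edgeList G) u v ≡ true) ×
  (∀ s → Dominates G (selection G s) → Irredundant G (selection G s) → edgeCount (selection G s) ≡ c)

Certificate⇒MinimalEDSsHaveSize : ∀ {G c} → Certificate G c → MinimalEDSsHaveSize G c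
Certificate⇒MinimalEDSsHaveSize {G} (covers , check) F minimal =
  trans (edgeCount-cong F≗) (check s (Dominates-resp {G} F≗ (proj₁ minimal))
                                     (Irredundant-resp {G} F≗ (minimal⇒Irredundant {G} {F} minimal)))
  where
  s : Subset (length (edgeList G))
  s = membership F (edgeList G)
  F≗ : mem F ≗₂ selection G s
  F≗ = mem≗chosen F (edgeList G) covers

dominates? : (G : Graph) (r : Rel (n G)) → Dec (Dominates G r)
dominates? G r = Finₚ.all? λ u → Finₚ.all? λ v →
  (adj G u v Bool.≟ true) →-dec ((r u v Bool.≟ false) →-dec
    Finₚ.any? λ w → (r u w Bool.≟ true) ⊎-dec (r v w Bool.≟ true))

irredundant? : (G : Graph) (r : Rel (n G)) → Dec (Irredundant G r)
irredundant? G r = Finₚ.all? λ a → Finₚ.all? λ b →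
  (r a b Bool.≟ true) →-dec ¬? (dominates? G (without (a , b) r))

allSubsets? : ∀ {k} {P : Subset k → Set} → (∀ s → Dec (P s)) → Dec (∀ s → P s)
allSubsets? P? = map′ (λ ∄¬ s → decidable-stable (P? s) (λ ¬Ps → ∄¬ (s , ¬Ps)))
                      (λ ∀P (s , ¬Ps) → ¬Ps (∀P s))
                      (¬? (anySubset? (¬? ∘ P?)))

certificate? : (G : Graph) (c : ℕ) → Dec (Certificate G c)
certificate? G c =
  (Finₚ.all? λ u → Finₚ.all? λ v → (adj G u v Bool.≟ true) →-dec (spanned (edgeList G) u v Bool.≟ true))
  ×-dec allSubsets? λ s → dominates? G (selection G s) →-dec
                          (irredundant? G (selection G s) →-dec (edgeCount (selection G s) ℕ.≟ c))

byEnumeration : (G : Graph) (c : ℕ) {_ : True (certificate? G c)} → MinimalEDSsHaveSize G c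
byEnumeration G c {ok} = Certificate⇒MinimalEDSsHaveSize (toWitness ok)

IsVertexCover : (G : Graph) → (Fin (n G) → Bool) → Set
IsVertexCover G P = ∀ u v → adj G u v ≡ true → P u ≡ true ⊎ P v ≡ true

record CoveringEdges {G : Graph} (F : EdgeSet G) (c : ℕ) : Set where
  field
    edges    : List (Edge (n G))
    length≡  : length edges ≡ c
    ⊆F       : All (λ (a , b) → mem F a b ≡ true) edges
    distinct : AllPairs Distinct edges
    covers   : IsVertexCover G (incident edges)

spanned⊆F : ∀ {G} (F : EdgeSet G) {es} → All (λ (a , b) → mem F a b ≡ true) es →
            ∀ u v → spanned es u v ≡ true → mem F u v ≡ true
spanned⊆F F {(a , b) ∷ _} (ab ∷ es⊆F) u v p with linked (a , b) u v in l
... | true  = trans (linked-mem F l) ab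
... | false = spanned⊆F F es⊆F u v p

spanning : ∀ {G} (F : EdgeSet G) {es} → All (λ (a , b) → mem F a b ≡ true) es → EdgeSet G
spanning F {es} es⊆F = record
  { mem = spanned es ; mem-sym = spanned-sym es ; mem-sub = λ u v → mem-sub F u v ∘ spanned⊆F F es⊆F u v }

vertexCover⇒Dominates : ∀ {G} (es : List (Edge (n G))) → IsVertexCover G (incident es) → Dominates G (spanned es)
vertexCover⇒Dominates es cover u v uv _ with cover u v uv
... | inj₁ pu = Product.map id inj₁ (incident⇒spanned es u pu)
... | inj₂ pv = Product.map id inj₂ (incident⇒spanned es v pv)

CoveringEdges⇒size : ∀ {G c} {F : EdgeSet G} → IsMinimalEDS F → CoveringEdges F c → size F ≡ c
CoveringEdges⇒size {G} {F = F} minimal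
  record { edges = es ; length≡ = refl ; ⊆F = es⊆F ; distinct = distinct ; covers = covers } =
  +-double-injective (begin
    size F + size F          ≡⟨ sym (arcs-size F) ⟩
    arcs (mem F)             ≡⟨ ∑²-cong (λ u v → cong count (F≗ u v)) ⟩
    arcs (spanned es)        ≡⟨ arcs-spanned (All.map (mem⇒≢ F) es⊆F) distinct ⟩
    length es + length es    ∎)
  where
  open ≡-Reasoning
  F≗ : mem F ≗₂ spanned es
  F≗ = minimal⇒sub-EDS-equal {G} {F} minimal (spanning F es⊆F) (spanned⊆F F es⊆F)
                              (vertexCover⇒Dominates {G} es covers)

coveringEdges₁ : ∀ {G} {F : EdgeSet G} {a b} → mem F a b ≡ true →
                 IsVertexCover G (incident ((a , b) ∷ [])) → CoveringEdges F 1
coveringEdges₁ ab cover = record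
  { edges = _ ∷ [] ; length≡ = refl ; ⊆F = ab ∷ [] ; distinct = [] ∷ [] ; covers = cover }

coveringEdges₂ : ∀ {G} {F : EdgeSet G} {a b c d} → mem F a b ≡ true → mem F c d ≡ true →
                 Distinct (a , b) (c , d) → IsVertexCover G (incident ((a , b) ∷ (c , d) ∷ [])) →
                 CoveringEdges F 2
coveringEdges₂ ab cd ab≠cd cover = record
  { edges = _ ∷ _ ∷ [] ; length≡ = refl ; ⊆F = ab ∷ cd ∷ [] ; distinct = (ab≠cd ∷ []) ∷ [] ∷ []
  ; covers = cover }

Star-leaves-nonadjacent : ∀ m (i j : Fin m) → adj (Star m) (suc i) (suc j) ≡ false
Star-leaves-nonadjacent m i j = ∧-zeroʳ _

Star-vertexCover : ∀ m (P : Fin (suc m) → Bool) → P 0F ≡ true → IsVertexCover (Star m) P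
Star-vertexCover m P p0 zero    v       _  = inj₁ p0
Star-vertexCover m P p0 (suc i) zero    _  = inj₂ p0
Star-vertexCover m P p0 (suc i) (suc j) ij =
  contradiction (trans (sym ij) (Star-leaves-nonadjacent m i j)) λ ()

Star-covering : ∀ m (F : EdgeSet (Star (suc m))) → IsEDS F → CoveringEdges F 1
Star-covering m F eds with EDS-touches F eds {0F} {1F} refl
... | inj₁ (_ , p)     = coveringEdges₁ p (Star-vertexCover _ _ refl)
... | inj₂ (0F , p)    = coveringEdges₁ (trans (mem-sym F 0F 1F) p) (Star-vertexCover _ _ refl)
... | inj₂ (suc j , p) = ⊥-elim (non-edge-∉ F (Star-leaves-nonadjacent (suc m) 0F j) p)

Star-size : ∀ m → MinimalEDSsHaveSize (Star (suc m)) 1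
Star-size m F minimal = CoveringEdges⇒size minimal (Star-covering m F (proj₁ minimal))

pattern leaf l = suc (suc (suc (suc l)))

mkAdj-mono : ∀ m {r s : ℕ → ℕ → Bool} → (∀ a b → r a b ≡ true → s a b ≡ true) →
             ∀ i j → mkAdj m r i j ≡ true → mkAdj m s i j ≡ true
mkAdj-mono m {r} {s} r⊆s i j ij with does (i ≟ j)
mkAdj-mono m r⊆s i j () | true
mkAdj-mono m {r} {s} r⊆s i j ij | false with ∨≡true {r (toℕ i) (toℕ j)} {r (toℕ j) (toℕ i)} ij
... | inj₁ rij rewrite r⊆s _ _ rij = refl
... | inj₂ rji rewrite r⊆s _ _ rji = ∨-zeroʳ (s (toℕ i) (toℕ j))

H2⊆H1 : ∀ k u v → adj (H2 k) u v ≡ true → adj (H1 (suc k)) u v ≡ true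
H2⊆H1 k = mkAdj-mono (5 + k) core⊆
  where
  core⊆ : ∀ a b → K4-minus-01 a b ∨ ((a ≡ᵇ 0) ∧ not (b <ᵇ 4)) ≡ true →
                  ((a <ᵇ 4) ∧ (b <ᵇ 4)) ∨ ((a ≡ᵇ 0) ∧ not (b <ᵇ 4)) ≡ true
  core⊆ a b ab with a <ᵇ 4 | b <ᵇ 4
  ... | true  | true  = refl
  ... | true  | false = ab
  ... | false | _     = ab

module _ (k : ℕ) where

  leaf-neighbour : ∀ l v → adj (H1 (suc k)) (leaf l) v ≡ true → v ≡ 0F
  leaf-neighbour l 0F       _  = refl
  leaf-neighbour l (leaf m) lm = contradiction (trans (sym lm) (∧-zeroʳ _)) λ ()

  data TriangleCover (P : Fin (5 + k) → Bool) : Set where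
    without₁ : P 2F ≡ true → P 3F ≡ true → TriangleCover P
    without₂ : P 1F ≡ true → P 3F ≡ true → TriangleCover P
    without₃ : P 1F ≡ true → P 2F ≡ true → TriangleCover P

  module _ {P : Fin (5 + k) → Bool} where
    covers₁₂ : TriangleCover P → P 1F ≡ true ⊎ P 2F ≡ true
    covers₁₂ (without₁ p₂ _) = inj₂ p₂
    covers₁₂ (without₂ p₁ _) = inj₁ p₁
    covers₁₂ (without₃ p₁ _) = inj₁ p₁

    covers₁₃ : TriangleCover P → P 1F ≡ true ⊎ P 3F ≡ true
    covers₁₃ (without₁ _ p₃) = inj₂ p₃
    covers₁₃ (without₂ p₁ _) = inj₁ p₁
    covers₁₃ (without₃ p₁ _) = inj₁ p₁

    covers₂₃ : TriangleCover P → P 2F ≡ true ⊎ P 3F ≡ true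
    covers₂₃ (without₁ p₂ _) = inj₁ p₂
    covers₂₃ (without₂ _ p₃) = inj₂ p₃
    covers₂₃ (without₃ _ p₂) = inj₁ p₂

    H1-vertexCover : P 0F ≡ true → TriangleCover P → IsVertexCover (H1 (suc k)) P
    H1-vertexCover p₀ _  0F v  _ = inj₁ p₀
    H1-vertexCover p₀ _  u  0F _ = inj₂ p₀
    H1-vertexCover p₀ tc 1F 2F _ = covers₁₂ tc
    H1-vertexCover p₀ tc 2F 1F _ = Sum.swap (covers₁₂ tc)
    H1-vertexCover p₀ tc 1F 3F _ = covers₁₃ tc
    H1-vertexCover p₀ tc 3F 1F _ = Sum.swap (covers₁₃ tc)
    H1-vertexCover p₀ tc 2F 3F _ = covers₂₃ tc
    H1-vertexCover p₀ tc 3F 2F _ = Sum.swap (covers₂₃ tc)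
    H1-vertexCover p₀ tc (leaf l) v lv with leaf-neighbour l v lv
    ... | refl = inj₂ p₀
    H1-vertexCover p₀ tc u (leaf l) ul with leaf-neighbour l u (trans (adj-sym (H1 (suc k)) (leaf l) u) ul)
    ... | refl = inj₁ p₀

  -- The argument only uses edges of ℋ₂ and non-edges of ℋ₁, so it applies to every graph in between.
  module _ (r : ℕ → ℕ → Bool)
           (H2⊆G : ∀ u v → adj (H2 k) u v ≡ true → mkAdj (5 + k) r u v ≡ true)
           (G⊆H1 : ∀ u v → mkAdj (5 + k) r u v ≡ true → adj (H1 (suc k)) u v ≡ true) where

    private
      G : Graph
      G = mkGraph (5 + k) r

    module _ (F : EdgeSet G) (eds : IsEDS F) where

      leaf-F-neighbour : ∀ {l v} → mem F (leaf l) v ≡ true → v ≡ 0F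
      leaf-F-neighbour lv = leaf-neighbour _ _ (G⊆H1 _ _ (mem-sub F _ _ lv))

      no-loop : ∀ {x} → mem F x x ≡ true → ⊥
      no-loop xx = mem⇒≢ F xx refl

      touching : ∀ {u v} → adj (H2 k) u v ≡ true → (∃ λ w → mem F u w ≡ true) ⊎ (∃ λ w → mem F v w ≡ true)
      touching uv = EDS-touches F eds (H2⊆G _ _ uv)

      pair : ∀ {b c d} → mem F 0F b ≡ true → mem F c d ≡ true → Distinct (0F , b) (c , d) →
             TriangleCover (incident ((0F , b) ∷ (c , d) ∷ [])) → CoveringEdges F 2
      pair ab cd ab≠cd tc = coveringEdges₂ ab cd ab≠cd λ u v uv → H1-vertexCover refl tc u v (G⊆H1 u v uv)

      apex-edge : ∃ λ w → mem F 0F w ≡ true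
      apex-edge with touching {0F} {leaf 0F} refl
      ... | inj₁ e = e
      ... | inj₂ (w , lw) with leaf-F-neighbour lw
      ...   | refl = leaf 0F , trans (mem-sym F 0F (leaf 0F)) lw

      from-apex₁ : mem F 0F 1F ≡ true → CoveringEdges F 2
      from-apex₁ p with touching {2F} {3F} refl
      ... | inj₁ (_ , q) = pair p q refl (without₃ refl refl)
      ... | inj₂ (_ , q) = pair p q refl (without₂ refl refl)

      from-apex₂ : mem F 0F 2F ≡ true → CoveringEdges F 2
      from-apex₂ p with touching {1F} {3F} refl
      ... | inj₁ (_ , q) = pair p q refl (without₃ refl refl)
      ... | inj₂ (_ , q) = pair p q refl (without₁ refl refl)

      from-apex₃ : mem F 0F 3F ≡ true → CoveringEdges F 2
      from-apex₃ p with touching {1F} {2F} refl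
      ... | inj₁ (_ , q) = pair p q refl (without₂ refl refl)
      ... | inj₂ (_ , q) = pair p q refl (without₁ refl refl)

      from-apex : ∀ w → mem F 0F w ≡ true → CoveringEdges F 2
      from-apex 0F p = ⊥-elim (no-loop p)
      from-apex 1F p = from-apex₁ p
      from-apex 2F p = from-apex₂ p
      from-apex 3F p = from-apex₃ p
      from-apex (leaf l) p with touching {1F} {2F} refl
      ... | inj₁ (0F , q)     = from-apex₁ (trans (mem-sym F 0F 1F) q)
      ... | inj₁ (1F , q)     = ⊥-elim (no-loop q)
      ... | inj₁ (2F , q)     = pair p q refl (without₃ refl refl)
      ... | inj₁ (3F , q)     = pair p q refl (without₂ refl refl)
      ... | inj₁ (leaf _ , q) = contradiction (leaf-F-neighbour (trans (mem-sym F _ 1F) q)) λ ()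
      ... | inj₂ (0F , q)     = from-apex₂ (trans (mem-sym F 0F 2F) q)
      ... | inj₂ (1F , q)     = pair p q refl (without₃ refl refl)
      ... | inj₂ (2F , q)     = ⊥-elim (no-loop q)
      ... | inj₂ (3F , q)     = pair p q refl (without₁ refl refl)
      ... | inj₂ (leaf _ , q) = contradiction (leaf-F-neighbour (trans (mem-sym F _ 2F) q)) λ ()

    between-H2-H1-size : MinimalEDSsHaveSize G 2
    between-H2-H1-size F minimal =
      CoveringEdges⇒size minimal (from-apex F (proj₁ minimal) _ (proj₂ (apex-edge F (proj₁ minimal))))

H1-size : ∀ k → MinimalEDSsHaveSize (H1 k) 2
H1-size zero    = byEnumeration (H1 0) 2
H1-size (suc k) = between-H2-H1-size k _ (H2⊆H1 k) (λ _ _ uv → uv)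

H2-size : ∀ k → MinimalEDSsHaveSize (H2 k) 2
H2-size k = between-H2-H1-size k _ (λ _ _ uv → uv) (H2⊆H1 k)

via : ∀ {G H c} → G ≅ H → MinimalEDSsHaveSize H c → ∃ (MinimalEDSsHaveSize G)
via i sized = _ , ≅-MinimalEDSsHaveSize i sized

family-size : (G : Graph) → InFamily G → ∃ (MinimalEDSsHaveSize G)
family-size G (inj₁ i)                                              = via i (byEnumeration (K 2) 1)
family-size G (inj₂ (inj₁ i))                                       = via i (byEnumeration (K 3) 1)
family-size G (inj₂ (inj₂ (inj₁ i)))                                = via i (byEnumeration (K 4) 2)
family-size G (inj₂ (inj₂ (inj₂ (inj₁ i))))                         = via i (byEnumeration H3 2)
family-size G (inj₂ (inj₂ (inj₂ (inj₂ (inj₁ (k , i))))))            = via i (H1-size k)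
family-size G (inj₂ (inj₂ (inj₂ (inj₂ (inj₂ (inj₁ (k , i)))))))     = via i (H2-size k)
family-size G (inj₂ (inj₂ (inj₂ (inj₂ (inj₂ (inj₂ (zero , i)))))))  = via i (byEnumeration (Star 0) 0)
family-size G (inj₂ (inj₂ (inj₂ (inj₂ (inj₂ (inj₂ (suc m , i))))))) = via i (Star-size m)

lemma12 : (G : Graph) → InFamily G → WellEdgeDominated G
lemma12 G family = MinimalEDSsHaveSize⇒WellEdgeDominated (proj₂ (family-size G family))
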